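{- For all formulas $\phi,\psi,\chi$ of $\mathcal{L}(\Delta)$, the formula $\Delta\phi\to\Delta(\phi\vee\psi)\vee\Delta(\neg\phi\vee\chi)$ is valid on the class of neighborhood frames satisfying $(s)$.
   Context: $\mathcal{L}(\Delta)$: $\phi::=p\mid\neg\phi\mid\phi\land\phi\mid\Delta\phi$, $p$ in a countable set $\mathbf{P}$ of variables; $\vee$ is the usual abbreviation. A neighborhood model is $\mathcal{M}=\langle S,N,V\rangle$ with $S\neq\emptyset$, $N:S\to\mathcal{P}(\mathcal{P}(S))$, $V:\mathbf{P}\to\mathcal{P}(S)$. Truth: $\mathcal{M},s\vDash p$ iff $s\in V(p)$; Boolean clauses as usual; $\mathcal{M},s\vDash\Delta\phi$ iff $\phi^{\mathcal{M}}\in N(s)$ or $S\setminus\phi^{\mathcal{M}}\in N(s)$, with $\phi^{\mathcal{M}}=\{s\mid\mathcal{M},s\vDash\phi\}$. A frame $\langle S,N\rangle$ satisfies $(s)$ if for every $s$, $X\in N(s)$ and $X\subseteq Y\subseteq S$ imply $Y\in N(s)$. Valid on a class of frames: true at every state of every model based on a frame of the class. -}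

module Defs where

open import Data.Nat using (ℕ)
open import Data.Product using (_×_)
open import Data.Sum using (_⊎_)
open import Relation.Nullary using (¬_)

data Form : Set where
  var : ℕ → Form
  ¬'_ : Form → Form
  _∧'_ : Form → Form → Form
  Δ : Form → Form

infixr 6 _∧'_
infixr 5 _∨'_
infixr 4 _⇒'_

_∨'_ : Form → Form → Form
φ ∨' ψ = ¬' (¬' φ ∧' ¬' ψ)

_⇒'_ : Form → Form → Form
φ ⇒' ψ = ¬' (φ ∧' ¬' ψ)

Subset : Set → Set₁
Subset S = S → Set

_⊆_ : {S : Set} → Subset S → Subset S → Set
X ⊆ Y = ∀ s → X s → Y s

record Frame : Set₂ where
  field
    S : Set
    inhabited : S
    N : S → Subset S → Set

record Model : Set₂ where
  field
    frame : Frame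
  open Frame frame public
  field
    V : ℕ → Subset S

module _ (M : Model) where
  open Model M

  _⊨_ : S → Form → Set
  s ⊨ var p = V p s
  s ⊨ (¬' φ) = ¬ (s ⊨ φ)
  s ⊨ (φ ∧' ψ) = (s ⊨ φ) × (s ⊨ ψ)
  s ⊨ Δ φ = N s (λ t → t ⊨ φ) ⊎ N s (λ t → ¬ (t ⊨ φ))

  ⟦_⟧ : Form → Subset S
  ⟦ φ ⟧ t = t ⊨ φ

ClosedUnderSupersets : Frame → Set₁
ClosedUnderSupersets F = ∀ (s : S) (X Y : Subset S) → N s X → X ⊆ Y → N s Y
  where open Frame F

ValidOn : (Frame → Set₁) → Form → Set₂
ValidOn C φ = ∀ (M : Model) → C (Model.frame M) → ∀ (s : Model.S M) → _⊨_ M s φ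

-- The premise Δφ holds because φ^M or its complement is a neighbourhood. The
-- first is contained in (φ ∨ ψ)^M, the second in (¬φ ∨ χ)^M, so closure under
-- supersets makes one of the two disjuncts of the conclusion true.
module Submission where

open import Defs
open import Data.Sum using (inj₁; inj₂)
open import Data.Product using (_,_)

module _ (M : Model) where
  open Model M

  ⊨-∨-introˡ : ∀ {s} (φ ψ : Form) → _⊨_ M s φ → _⊨_ M s (φ ∨' ψ)
  ⊨-∨-introˡ φ ψ sφ (s¬φ , _) = s¬φ sφ

  ⊨-∨-introʳ : ∀ {s} (φ ψ : Form) → _⊨_ M s ψ → _⊨_ M s (φ ∨' ψ)
  ⊨-∨-introʳ φ ψ sψ (_ , s¬ψ) = s¬ψ sψ

  ⊨-⇒-intro : ∀ {s} (φ ψ : Form) → (_⊨_ M s φ → _⊨_ M s ψ) → _⊨_ M s (φ ⇒' ψ)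
  ⊨-⇒-intro φ ψ φ→ψ (sφ , s¬ψ) = s¬ψ (φ→ψ sφ)

  ⊨-Δ-superset : ClosedUnderSupersets frame → ∀ {s} (φ ψ : Form) →
    N s (⟦_⟧ M φ) → ⟦_⟧ M φ ⊆ ⟦_⟧ M ψ → _⊨_ M s (Δ ψ)
  ⊨-Δ-superset closed {s} φ ψ Nφ φ⊆ψ = inj₁ (closed s (⟦_⟧ M φ) (⟦_⟧ M ψ) Nφ φ⊆ψ)

mainTheorem8 : ∀ (φ ψ χ : Form) →
    ValidOn ClosedUnderSupersets (Δ φ ⇒' (Δ (φ ∨' ψ) ∨' Δ (¬' φ ∨' χ)))
mainTheorem8 φ ψ χ M closed s = ⊨-⇒-intro M (Δ φ) (Δ (φ ∨' ψ) ∨' Δ (¬' φ ∨' χ)) λ where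
  (inj₁ Nφ) → ⊨-∨-introˡ M (Δ (φ ∨' ψ)) (Δ (¬' φ ∨' χ))
    (⊨-Δ-superset M closed φ (φ ∨' ψ) Nφ (λ t → ⊨-∨-introˡ M φ ψ))
  (inj₂ N¬φ) → ⊨-∨-introʳ M (Δ (φ ∨' ψ)) (Δ (¬' φ ∨' χ))
    (⊨-Δ-superset M closed (¬' φ) (¬' φ ∨' χ) N¬φ (λ t → ⊨-∨-introˡ M (¬' φ) χ))
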